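{- Let $n\ge1$ be an integer and $\beta$ a complex number, and define the polynomial $P_n(x)$ by $$\frac{P_n(x)}{(1-x)^{n+1}}=\sum_{m\ge0}\frac{m}{m+n\beta}\binom{m+n\beta}{n}x^m .$$ Then $$P_n(x)=\frac1n\sum_{m=1}^{n}\binom{n(1-\beta)}{m-1}\binom{n\beta}{n-m}x^m .$$
   Context: $\binom{c}{k}=c(c-1)\cdots(c-k+1)/k!$ for complex $c$ and integers $k\ge0$. The coefficient $\frac{m}{m+n\beta}\binom{m+n\beta}{n}$ is understood as the polynomial expression $\frac{m}{n}\binom{m+n\beta-1}{n-1}$ in $m$ (so no division by zero occurs). Here $\sum_m \frac{m}{m+n\beta}\binom{m+n\beta}{n}x^m$ is the $n$th descending diagonal of the Riordan array $(1,x\,{}_{(\beta)}a(x))$, where ${}_{(\beta)}a(x)$ is the generalized binomial series $\sum_{k\ge0}\frac{1}{1+k\beta}\binom{1+k\beta}{k}x^k$. -}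

module Defs where

open import Algebra.Bundles using (CommutativeRing)
open import Data.Bool using (if_then_else_)
open import Data.Nat as ℕ using (ℕ; zero; suc; _∸_; _≤ᵇ_)
open import Data.Nat.Combinatorics using (_C_)

-- Everything is done over an arbitrary commutative ring R in which every
-- positive integer is invertible (a ℚ-algebra, e.g. ℂ).
module QAlg {c ℓ} (R : CommutativeRing c ℓ) where
  open CommutativeRing R

  natC : ℕ → Carrier
  natC zero = 0#
  natC (suc n) = 1# + natC n

  IsInvNat : (ℕ → Carrier) → Set ℓ
  IsInvNat inv = ∀ k → natC (suc k) * inv k ≈ 1#

  module WithInv (inv : ℕ → Carrier) where

    falling : Carrier → ℕ → Carrier
    falling x zero = 1#
    falling x (suc k) = falling x k * (x - natC k)

    invFact : ℕ → Carrier
    invFact zero = 1#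
    invFact (suc k) = invFact k * inv k

    binom : Carrier → ℕ → Carrier
    binom x k = falling x k * invFact k

    sign : ℕ → Carrier
    sign zero = 1#
    sign (suc j) = - sign j

    sumTo : ℕ → (ℕ → Carrier) → Carrier
    sumTo zero f = f 0
    sumTo (suc m) f = sumTo m f + f (suc m)

    -- With n = suc k: coefficient of x^m in  Σ_m (m/(m+nβ)) C(m+nβ, n) x^m,
    -- read as the polynomial (m/n) C(m+nβ-1, n-1).
    diagCoeff : ℕ → Carrier → ℕ → Carrier
    diagCoeff k β m = natC m * inv k * binom (natC m + natC (suc k) * β - 1#) k

    -- coefficient of x^m in P_n(x) = (1-x)^(n+1) * Σ_m diagCoeff x^m, n = suc k
    Pcoeff : ℕ → Carrier → ℕ → Carrier
    Pcoeff k β m =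
      sumTo m (λ j → sign j * natC (suc (suc k) C j) * diagCoeff k β (m ∸ j))

    -- coefficient of x^m in (1/n) Σ_{i=1}^{n} C(n(1-β), i-1) C(nβ, n-i) x^i, n = suc k
    rhsCoeff : ℕ → Carrier → ℕ → Carrier
    rhsCoeff k β zero = 0#
    rhsCoeff k β (suc i) =
      if i ≤ᵇ k
      then inv k * binom (natC (suc k) * (1# - β)) i * binom (natC (suc k) * β) (k ∸ i)
      else 0#

module Submission where

-- Work in a commutative ring R where 1, 2, 3, … are invertible; put n = k+1,
-- a = nβ and b = n(1-β), so that a + b = n.  The proof has three steps.
--  1. (Weights) With w(u) = binom(a,u)·binom(b,k-u), for every t ∈ ℕ
--       t·binom(a+t-1, k) = Σ_{u≤k} w(u)·C(t+u, n),
--     by Vandermonde's convolution and trinomial revision, which reduce the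
--     binomial moments Σ_u w(u)·binom(u,s) to binom(a,s)·(n-s).
--  2. (Differences) Multiplying Σ_t C(t+u, n) x^t by (1-x)^(n+1) leaves the
--     single monomial x^(n-u), for u ≤ n.
--  3. (Numerator) Hence P_n(x) = (1/n)·Σ_{u≤k} w(u)·x^(n-u), and reading off
--     the coefficient of x^(i+1) (u = k-i) gives the claimed formula.

open import Defs
open import Algebra.Bundles using (CommutativeRing)
open import Data.Nat as ℕ using (ℕ; zero; suc; _∸_; _≤_; _<_; z≤n; s≤s; _≤ᵇ_)
import Data.Nat.Properties as ℕP
open import Data.Nat.Combinatorics
  using (_C_; nCk+nC[k+1]≡[n+1]C[k+1]; k>n⇒nCk≡0; nCn≡1; nC1≡n; nCk≡nC[n∸k])
open import Data.Integer as ℤ using (ℤ; +_; -[1+_]; 1ℤ)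
import Data.Integer.Properties as ℤP
open import Data.Sign as Sign using (Sign)
import Data.Maybe as Maybe
open import Data.Bool using (true; false; T)
open import Data.Empty using (⊥-elim)
open import Relation.Nullary using (¬_; yes; no)
open import Relation.Binary.PropositionalEquality as P using (_≡_; _≢_)
open import Relation.Binary.Consequences using (dec⇒weaklyDec)
open import Algebra.Solver.Ring.AlmostCommutativeRing
  using (AlmostCommutativeRing; fromCommutativeRing; _-Raw-AlmostCommutative⟶_)

module IntegerCoefficients {c ℓ} (R : CommutativeRing c ℓ) where
  open CommutativeRing R
  open import Algebra.Properties.Ring ring using (-‿involutive; -0#≈0#; -‿distribˡ-*; -‿distribʳ-*; -‿+-comm)
  open import Algebra.Properties.Semiring.Mult.TCOptimised semiring using (_×_; 1+×; ×-homo-+; ×1-homo-*)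
  open import Algebra.Properties.CommutativeSemigroup +-commutativeSemigroup
    using () renaming (interchange to +-interchange)
  open import Algebra.Properties.CommutativeSemigroup *-commutativeSemigroup
    using () renaming (interchange to *-interchange)
  open import Relation.Binary.Reasoning.Setoid setoid

  private
    -- n ↦ n·1#, normalised so that 0 ↦ 0# and 1 ↦ 1# hold definitionally
    num : ℕ → Carrier
    num n = n × 1#

    embed : ℤ → Carrier
    embed (+ n) = num n
    embed -[1+ n ] = - num (suc n)

    cancel-common : ∀ x y z → (x + y) - (x + z) ≈ y - z
    cancel-common x y z = begin
      (x + y) - (x + z)        ≈⟨ +-congˡ (sym (-‿+-comm x z)) ⟩
      (x + y) + (- x + - z)    ≈⟨ +-interchange x y (- x) (- z) ⟩
      (x - x) + (y - z)        ≈⟨ +-congʳ (-‿inverseʳ x) ⟩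
      0# + (y - z)             ≈⟨ +-identityˡ _ ⟩
      y - z                    ∎

    ⊖-homo : ∀ m n → embed (m ℤ.⊖ n) ≈ num m - num n
    ⊖-homo zero zero = sym (-‿inverseʳ 0#)
    ⊖-homo zero (suc n) = sym (+-identityˡ _)
    ⊖-homo (suc m) zero = sym (trans (+-congˡ -0#≈0#) (+-identityʳ _))
    ⊖-homo (suc m) (suc n) = begin
      embed (suc m ℤ.⊖ suc n)     ≡⟨ P.cong embed (ℤP.[1+m]⊖[1+n]≡m⊖n m n) ⟩
      embed (m ℤ.⊖ n)             ≈⟨ ⊖-homo m n ⟩
      num m - num n               ≈⟨ sym (cancel-common 1# (num m) (num n)) ⟩
      (1# + num m) - (1# + num n) ≈⟨ sym (+-cong (1+× m 1#) (-‿cong (1+× n 1#))) ⟩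
      num (suc m) - num (suc n)   ∎

    +-homo : ∀ i j → embed (i ℤ.+ j) ≈ embed i + embed j
    +-homo -[1+ m ] -[1+ n ] = begin
      - num (suc (suc (m ℕ.+ n)))    ≡⟨ P.cong (λ v → - num (suc v)) (P.sym (ℕP.+-suc m n)) ⟩
      - num (suc m ℕ.+ suc n)        ≈⟨ -‿cong (×-homo-+ 1# (suc m) (suc n)) ⟩
      - (num (suc m) + num (suc n))  ≈⟨ sym (-‿+-comm _ _) ⟩
      embed -[1+ m ] + embed -[1+ n ] ∎
    +-homo -[1+ m ] (+ n) = trans (⊖-homo n (suc m)) (+-comm _ _)
    +-homo (+ m) -[1+ n ] = ⊖-homo m (suc n)
    +-homo (+ m) (+ n) = ×-homo-+ 1# m n

    sgn : Sign → Carrier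
    sgn Sign.+ = 1#
    sgn Sign.- = - 1#

    ◃-homo : ∀ s n → embed (s ℤ.◃ n) ≈ sgn s * num n
    ◃-homo s zero = sym (zeroʳ _)
    ◃-homo Sign.+ (suc n) = sym (*-identityˡ _)
    ◃-homo Sign.- (suc n) = trans (-‿cong (sym (*-identityˡ _))) (-‿distribˡ-* _ _)

    sgn-* : ∀ s t → sgn (s Sign.* t) ≈ sgn s * sgn t
    sgn-* Sign.+ t = sym (*-identityˡ _)
    sgn-* Sign.- Sign.+ = sym (*-identityʳ _)
    sgn-* Sign.- Sign.- = begin
      1#                 ≈⟨ sym (-‿involutive 1#) ⟩
      - - 1#             ≈⟨ -‿cong (-‿cong (sym (*-identityˡ 1#))) ⟩
      - - (1# * 1#)      ≈⟨ -‿cong (-‿distribˡ-* 1# 1#) ⟩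
      - (- 1# * 1#)      ≈⟨ -‿distribʳ-* (- 1#) 1# ⟩
      - 1# * - 1#        ∎

    *-homo : ∀ i j → embed (i ℤ.* j) ≈ embed i * embed j
    *-homo i j = begin
      embed (ℤ.sign i Sign.* ℤ.sign j ℤ.◃ ℤ.∣ i ∣ ℕ.* ℤ.∣ j ∣)
        ≈⟨ ◃-homo (ℤ.sign i Sign.* ℤ.sign j) (ℤ.∣ i ∣ ℕ.* ℤ.∣ j ∣) ⟩
      sgn (ℤ.sign i Sign.* ℤ.sign j) * num (ℤ.∣ i ∣ ℕ.* ℤ.∣ j ∣)
        ≈⟨ *-cong (sgn-* (ℤ.sign i) (ℤ.sign j)) (×1-homo-* ℤ.∣ i ∣ ℤ.∣ j ∣) ⟩
      (sgn (ℤ.sign i) * sgn (ℤ.sign j)) * (num ℤ.∣ i ∣ * num ℤ.∣ j ∣)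
        ≈⟨ *-interchange _ _ _ _ ⟩
      (sgn (ℤ.sign i) * num ℤ.∣ i ∣) * (sgn (ℤ.sign j) * num ℤ.∣ j ∣)
        ≈⟨ sym (*-cong (◃-homo (ℤ.sign i) ℤ.∣ i ∣) (◃-homo (ℤ.sign j) ℤ.∣ j ∣)) ⟩
      embed (ℤ.sign i ℤ.◃ ℤ.∣ i ∣) * embed (ℤ.sign j ℤ.◃ ℤ.∣ j ∣)
        ≡⟨ P.cong₂ (λ i′ j′ → embed i′ * embed j′) (ℤP.◃-inverse i) (ℤP.◃-inverse j) ⟩
      embed i * embed j ∎

    neg-homo : ∀ i → embed (ℤ.- i) ≈ - embed i
    neg-homo -[1+ n ] = sym (-‿involutive _)
    neg-homo (+ zero) = sym -0#≈0#
    neg-homo (+ suc n) = refl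

    R′ : AlmostCommutativeRing c ℓ
    R′ = fromCommutativeRing R

    homomorphism : ℤ.+-*-rawRing -Raw-AlmostCommutative⟶ R′
    homomorphism = record
      { ⟦_⟧ = embed ; +-homo = +-homo ; *-homo = *-homo ; -‿homo = neg-homo
      ; 0-homo = refl ; 1-homo = refl }

    weakly-decide : ∀ i j → Maybe.Maybe (embed i ≈ embed j)
    weakly-decide i j = Maybe.map (λ { P.refl → refl }) (dec⇒weaklyDec ℤP._≟_ i j)

  open import Algebra.Solver.Ring ℤ.+-*-rawRing R′ homomorphism weakly-decide public

module FiniteSums {c ℓ} (R : CommutativeRing c ℓ) (inv : ℕ → CommutativeRing.Carrier R) where
  open CommutativeRing R hiding (zero)
  open QAlg R using (natC)
  open QAlg.WithInv R inv using (sumTo)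
  open import Algebra.Properties.Ring ring using (-‿+-comm)
  open import Algebra.Properties.CommutativeSemigroup +-commutativeSemigroup
    using () renaming (interchange to +-interchange)
  open import Relation.Binary.Reasoning.Setoid setoid

  natC-+ : ∀ m n → natC (m ℕ.+ n) ≈ natC m + natC n
  natC-+ zero n = sym (+-identityˡ _)
  natC-+ (suc m) n = trans (+-congˡ (natC-+ m n)) (sym (+-assoc _ _ _))

  natC-split : ∀ {s k} → s ≤ k → natC k ≈ natC s + natC (k ∸ s)
  natC-split {s} {k} s≤k =
    trans (reflexive (P.cong natC (P.sym (ℕP.m+[n∸m]≡n s≤k)))) (natC-+ s (k ∸ s))

  sum-cong : ∀ m {f g : ℕ → Carrier} → (∀ j → j ≤ m → f j ≈ g j) → sumTo m f ≈ sumTo m g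
  sum-cong zero f≈g = f≈g 0 z≤n
  sum-cong (suc m) f≈g =
    +-cong (sum-cong m (λ j j≤m → f≈g j (ℕP.m≤n⇒m≤1+n j≤m))) (f≈g (suc m) ℕP.≤-refl)

  sum-vanish : ∀ m (f : ℕ → Carrier) → (∀ j → j ≤ m → f j ≈ 0#) → sumTo m f ≈ 0#
  sum-vanish zero f f≈0 = f≈0 0 z≤n
  sum-vanish (suc m) f f≈0 = trans
    (+-cong (sum-vanish m f (λ j j≤m → f≈0 j (ℕP.m≤n⇒m≤1+n j≤m))) (f≈0 (suc m) ℕP.≤-refl))
    (+-identityˡ 0#)

  sum-+ : ∀ m (f g : ℕ → Carrier) → sumTo m (λ j → f j + g j) ≈ sumTo m f + sumTo m g
  sum-+ zero f g = refl
  sum-+ (suc m) f g = trans (+-congʳ (sum-+ m f g)) (+-interchange _ _ _ _)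

  sum-neg : ∀ m (f : ℕ → Carrier) → sumTo m (λ j → - f j) ≈ - sumTo m f
  sum-neg zero f = refl
  sum-neg (suc m) f = trans (+-congʳ (sum-neg m f)) (-‿+-comm _ _)

  sum-scale : ∀ m x (f : ℕ → Carrier) → x * sumTo m f ≈ sumTo m (λ j → x * f j)
  sum-scale zero x f = refl
  sum-scale (suc m) x f = trans (distribˡ _ _ _) (+-congʳ (sum-scale m x f))

  sum-unfoldˡ : ∀ m (f : ℕ → Carrier) → sumTo (suc m) f ≈ f 0 + sumTo m (λ j → f (suc j))
  sum-unfoldˡ zero f = refl
  sum-unfoldˡ (suc m) f = trans (+-congʳ (sum-unfoldˡ m f)) (+-assoc _ _ _)

  sum-interchange : ∀ m n (F : ℕ → ℕ → Carrier) →
    sumTo m (λ i → sumTo n (F i)) ≈ sumTo n (λ j → sumTo m (λ i → F i j))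
  sum-interchange zero n F = refl
  sum-interchange (suc m) n F = trans (+-congʳ (sum-interchange m n F)) (sym (sum-+ n _ _))

  sum-single : ∀ m i (f : ℕ → Carrier) → i ≤ m → (∀ j → j ≤ m → j ≢ i → f j ≈ 0#) →
    sumTo m f ≈ f i
  sum-single zero .zero f z≤n f≈0 = refl
  sum-single (suc m) i f i≤1+m f≈0 with i ℕP.≟ suc m
  ... | yes P.refl = trans
    (+-congʳ (sum-vanish m f (λ j j≤m → f≈0 j (ℕP.m≤n⇒m≤1+n j≤m) (ℕP.<⇒≢ (s≤s j≤m)))))
    (+-identityˡ _)
  ... | no i≢1+m = trans
    (+-cong (sum-single m i f (ℕP.≤-pred (ℕP.≤∧≢⇒< i≤1+m i≢1+m))
                          (λ j j≤m → f≈0 j (ℕP.m≤n⇒m≤1+n j≤m)))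
            (f≈0 (suc m) ℕP.≤-refl (λ 1+m≡i → i≢1+m (P.sym 1+m≡i))))
    (+-identityʳ _)

  sum-dropInitial : ∀ s m (f : ℕ → Carrier) → s ≤ m → (∀ j → j < s → f j ≈ 0#) →
    sumTo m f ≈ sumTo (m ∸ s) (λ j → f (s ℕ.+ j))
  sum-dropInitial zero m f s≤m f≈0 = refl
  sum-dropInitial (suc s) (suc m) f (s≤s s≤m) f≈0 = begin
    sumTo (suc m) f                           ≈⟨ sum-unfoldˡ m f ⟩
    f 0 + sumTo m (λ j → f (suc j))           ≈⟨ +-congʳ (f≈0 0 (s≤s z≤n)) ⟩
    0# + sumTo m (λ j → f (suc j))            ≈⟨ +-identityˡ _ ⟩
    sumTo m (λ j → f (suc j))
      ≈⟨ sum-dropInitial s m (λ j → f (suc j)) s≤m (λ j j<s → f≈0 (suc j) (s≤s j<s)) ⟩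
    sumTo (m ∸ s) (λ j → f (suc (s ℕ.+ j)))   ∎

module Binomials {c ℓ} (R : CommutativeRing c ℓ) (inv : ℕ → CommutativeRing.Carrier R)
                 (isInv : QAlg.IsInvNat R inv) where
  open CommutativeRing R hiding (zero)
  open QAlg R
  open WithInv inv
  open IntegerCoefficients R using (solve; _:=_; _:+_; _:*_; _:-_; con)
  open FiniteSums R inv
  open import Algebra.Properties.Ring ring using (-0#≈0#)
  open import Algebra.Properties.CommutativeSemigroup *-commutativeSemigroup
    using (x∙yz≈y∙xz; x∙yz≈yx∙z)
  open import Relation.Binary.Reasoning.Setoid setoid

  binom-cong : ∀ k {x y} → x ≈ y → binom x k ≈ binom y k
  binom-cong k {x} {y} x≈y = *-congʳ (falling-cong k)
    where
    falling-cong : ∀ k → falling x k ≈ falling y k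
    falling-cong zero = refl
    falling-cong (suc k) = *-cong (falling-cong k) (+-congʳ x≈y)

  binom-zero : ∀ x → binom x 0 ≈ 1#
  binom-zero x = *-identityˡ 1#

  unit-factor : ∀ k X → X * (natC (suc k) * inv k) ≈ X
  unit-factor k X = trans (*-congˡ (isInv k)) (*-identityʳ X)

  natC-cancel : ∀ k {A B} → natC (suc k) * A ≈ natC (suc k) * B → A ≈ B
  natC-cancel k {A} {B} eq = begin
    A                          ≈⟨ sym (undo A) ⟩
    inv k * (natC (suc k) * A) ≈⟨ *-congˡ eq ⟩
    inv k * (natC (suc k) * B) ≈⟨ undo B ⟩
    B                          ∎
    where
    undo : ∀ X → inv k * (natC (suc k) * X) ≈ X
    undo X = trans (x∙yz≈yx∙z _ _ X) (trans (*-congʳ (isInv k)) (*-identityˡ X))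

  absorption : ∀ k x → natC (suc k) * binom x (suc k) ≈ (x - natC k) * binom x k
  absorption k x = begin
    natC (suc k) * (falling x k * (x - natC k) * (invFact k * inv k))
      ≈⟨ solve 5 (λ N F D I i → N :* (F :* D :* (I :* i)) := (D :* (F :* I)) :* (N :* i))
               refl (natC (suc k)) (falling x k) (x - natC k) (invFact k) (inv k) ⟩
    (x - natC k) * binom x k * (natC (suc k) * inv k) ≈⟨ unit-factor k _ ⟩
    (x - natC k) * binom x k                           ∎

  falling-shift : ∀ k x → falling (x + 1#) (suc k) ≈ (x + 1#) * falling x k
  falling-shift zero x =
    solve 1 (λ x → con 1ℤ :* ((x :+ con 1ℤ) :- con (+ 0)) := (x :+ con 1ℤ) :* con 1ℤ) refl x
  falling-shift (suc k) x = begin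
    falling (x + 1#) (suc k) * ((x + 1#) - (1# + natC k)) ≈⟨ *-congʳ (falling-shift k x) ⟩
    ((x + 1#) * falling x k) * ((x + 1#) - (1# + natC k))
      ≈⟨ solve 3 (λ x F K → ((x :+ con 1ℤ) :* F) :* ((x :+ con 1ℤ) :- (con 1ℤ :+ K))
                            := (x :+ con 1ℤ) :* (F :* (x :- K))) refl x (falling x k) (natC k) ⟩
    (x + 1#) * falling x (suc k) ∎

  pascal : ∀ k x → binom (x + 1#) (suc k) ≈ binom x (suc k) + binom x k
  pascal k x = begin
    falling (x + 1#) (suc k) * (invFact k * inv k) ≈⟨ *-congʳ (falling-shift k x) ⟩
    ((x + 1#) * falling x k) * (invFact k * inv k)
      ≈⟨ solve 5 (λ x F K I i → ((x :+ con 1ℤ) :* F) :* (I :* i)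
                                := F :* (x :- K) :* (I :* i) :+ (F :* I) :* ((con 1ℤ :+ K) :* i))
               refl x (falling x k) (natC k) (invFact k) (inv k) ⟩
    binom x (suc k) + binom x k * (natC (suc k) * inv k) ≈⟨ +-congˡ (unit-factor k _) ⟩
    binom x (suc k) + binom x k                          ∎

  absorption′ : ∀ j y → natC (suc j) * binom y (suc j) ≈ y * binom (y - 1#) j
  absorption′ j y = begin
    natC (suc j) * binom y (suc j) ≈⟨ *-congˡ (binom-cong (suc j) (sym y-1+1≈y)) ⟩
    natC (suc j) * (falling ((y - 1#) + 1#) (suc j) * (invFact j * inv j))
      ≈⟨ *-congˡ (*-congʳ (falling-shift j (y - 1#))) ⟩
    natC (suc j) * (((y - 1#) + 1#) * falling (y - 1#) j * (invFact j * inv j))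
      ≈⟨ solve 5 (λ N Y F I i → N :* (Y :* F :* (I :* i)) := (Y :* (F :* I)) :* (N :* i))
               refl (natC (suc j)) ((y - 1#) + 1#) (falling (y - 1#) j) (invFact j) (inv j) ⟩
    ((y - 1#) + 1#) * binom (y - 1#) j * (natC (suc j) * inv j) ≈⟨ unit-factor j _ ⟩
    ((y - 1#) + 1#) * binom (y - 1#) j                          ≈⟨ *-congʳ y-1+1≈y ⟩
    y * binom (y - 1#) j                                        ∎
    where
    y-1+1≈y : (y - 1#) + 1# ≈ y
    y-1+1≈y = solve 1 (λ y → (y :- con 1ℤ) :+ con 1ℤ := y) refl y

  natC-binom : ∀ N j → natC (N C j) ≈ binom (natC N) j
  natC-binom N zero = trans (+-identityʳ 1#) (sym (binom-zero (natC N)))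
  natC-binom zero (suc j) = sym (trans (*-congʳ (falling-zero j)) (zeroˡ _))
    where
    falling-zero : ∀ j → falling 0# (suc j) ≈ 0#
    falling-zero zero = trans (*-identityˡ _) (-‿inverseʳ 0#)
    falling-zero (suc j) = trans (*-congʳ (falling-zero j)) (zeroˡ _)
  natC-binom (suc N) (suc j) = begin
    natC (suc N C suc j)                      ≡⟨ P.cong natC (P.sym (nCk+nC[k+1]≡[n+1]C[k+1] N j)) ⟩
    natC (N C j ℕ.+ N C suc j)                ≈⟨ natC-+ (N C j) (N C suc j) ⟩
    natC (N C j) + natC (N C suc j)           ≈⟨ +-cong (natC-binom N j) (natC-binom N (suc j)) ⟩
    binom (natC N) j + binom (natC N) (suc j) ≈⟨ +-comm _ _ ⟩
    binom (natC N) (suc j) + binom (natC N) j ≈⟨ sym (pascal j (natC N)) ⟩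
    binom (natC N + 1#) (suc j)               ≈⟨ binom-cong (suc j) (+-comm _ _) ⟩
    binom (natC (suc N)) (suc j)              ∎

  binom-nat-vanish : ∀ {u s} → u < s → binom (natC u) s ≈ 0#
  binom-nat-vanish {u} {s} u<s = trans (sym (natC-binom u s)) (reflexive (P.cong natC (k>n⇒nCk≡0 u<s)))

  binom-nat-pred : ∀ r → binom (natC (suc r)) r ≈ natC (suc r)
  binom-nat-pred r = trans (sym (natC-binom (suc r) r)) (reflexive (P.cong natC [1+r]Cr≡1+r))
    where
    [1+r]Cr≡1+r : suc r C r ≡ suc r
    [1+r]Cr≡1+r = P.trans (nCk≡nC[n∸k] (ℕP.n≤1+n r))
                  (P.trans (P.cong (suc r C_) (ℕP.m+n∸n≡m 1 r)) (nC1≡n (suc r)))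

  vandermonde : ∀ k x y → sumTo k (λ s → binom x s * binom y (k ∸ s)) ≈ binom (x + y) k
  vandermonde zero x y =
    trans (*-cong (binom-zero x) (binom-zero y)) (trans (*-identityˡ 1#) (sym (binom-zero (x + y))))
  vandermonde (suc k) x y = natC-cancel k (begin
    natC (suc k) * sumTo (suc k) A
      ≈⟨ sum-scale (suc k) _ A ⟩
    sumTo (suc k) (λ s → natC (suc k) * A s)
      ≈⟨ sum-cong (suc k) (λ s s≤ → trans (*-congʳ (natC-split s≤)) (distribʳ _ _ _)) ⟩
    sumTo (suc k) (λ s → natC s * A s + natC (suc k ∸ s) * A s)
      ≈⟨ sum-+ (suc k) _ _ ⟩
    sumTo (suc k) (λ s → natC s * A s) + sumTo (suc k) (λ s → natC (suc k ∸ s) * A s)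
      ≈⟨ +-cong absorb-x absorb-y ⟩
    sumTo k (λ s → (x - natC s) * A′ s) + sumTo k (λ s → (y - natC (k ∸ s)) * A′ s)
      ≈⟨ sym (sum-+ k _ _) ⟩
    sumTo k (λ s → (x - natC s) * A′ s + (y - natC (k ∸ s)) * A′ s)
      ≈⟨ sum-cong k collect ⟩
    sumTo k (λ s → (x + y - natC k) * A′ s)
      ≈⟨ sym (sum-scale k _ A′) ⟩
    (x + y - natC k) * sumTo k A′
      ≈⟨ *-congˡ (vandermonde k x y) ⟩
    (x + y - natC k) * binom (x + y) k
      ≈⟨ sym (absorption k (x + y)) ⟩
    natC (suc k) * binom (x + y) (suc k) ∎)
    where
    A A′ : ℕ → Carrier
    A s = binom x s * binom y (suc k ∸ s)
    A′ s = binom x s * binom y (k ∸ s)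

    absorb-x : sumTo (suc k) (λ s → natC s * A s) ≈ sumTo k (λ s → (x - natC s) * A′ s)
    absorb-x = begin
      sumTo (suc k) (λ s → natC s * A s)
        ≈⟨ sum-unfoldˡ k _ ⟩
      0# * A 0 + sumTo k (λ s → natC (suc s) * A (suc s))
        ≈⟨ +-cong (zeroˡ _) (sum-cong k (λ s _ →
             trans (sym (*-assoc _ _ _)) (trans (*-congʳ (absorption s x)) (*-assoc _ _ _)))) ⟩
      0# + sumTo k (λ s → (x - natC s) * A′ s)
        ≈⟨ +-identityˡ _ ⟩
      sumTo k (λ s → (x - natC s) * A′ s) ∎

    absorb-y : sumTo (suc k) (λ s → natC (suc k ∸ s) * A s) ≈ sumTo k (λ s → (y - natC (k ∸ s)) * A′ s)
    absorb-y = trans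
      (+-cong (sum-cong k absorb-y-term) (trans (*-congʳ (reflexive (P.cong natC (ℕP.n∸n≡0 k)))) (zeroˡ _)))
      (+-identityʳ _)
      where
      absorb-y-term : ∀ s → s ≤ k → natC (suc k ∸ s) * A s ≈ (y - natC (k ∸ s)) * A′ s
      absorb-y-term s s≤k rewrite ℕP.+-∸-assoc 1 s≤k = begin
        natC (suc (k ∸ s)) * (binom x s * binom y (suc (k ∸ s)))   ≈⟨ x∙yz≈y∙xz _ _ _ ⟩
        binom x s * (natC (suc (k ∸ s)) * binom y (suc (k ∸ s)))   ≈⟨ *-congˡ (absorption (k ∸ s) y) ⟩
        binom x s * ((y - natC (k ∸ s)) * binom y (k ∸ s))         ≈⟨ x∙yz≈y∙xz _ _ _ ⟩
        (y - natC (k ∸ s)) * A′ s                                  ∎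

    collect : ∀ s → s ≤ k → (x - natC s) * A′ s + (y - natC (k ∸ s)) * A′ s ≈ (x + y - natC k) * A′ s
    collect s s≤k = trans (sym (distribʳ _ _ _)) (*-congʳ (trans
      (solve 4 (λ x y a b → (x :- a) :+ (y :- b) := x :+ y :- (a :+ b)) refl x y (natC s) (natC (k ∸ s)))
      (+-congˡ (-‿cong (sym (natC-split s≤k))))))

  trinomial : ∀ x s j → binom x (s ℕ.+ j) * binom (natC (s ℕ.+ j)) s ≈ binom x s * binom (x - natC s) j
  trinomial x zero j = begin
    binom x j * binom (natC j) 0  ≈⟨ *-congˡ (binom-zero (natC j)) ⟩
    binom x j * 1#                ≈⟨ *-comm _ _ ⟩
    1# * binom x j                ≈⟨ *-cong (sym (binom-zero x)) (binom-cong j (sym x-0≈x)) ⟩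
    binom x 0 * binom (x - 0#) j  ∎
    where
    x-0≈x : x - 0# ≈ x
    x-0≈x = trans (+-congˡ -0#≈0#) (+-identityʳ x)
  trinomial x (suc s) j = natC-cancel s (begin
    natC (suc s) * (binom x N * binom (natC N) (suc s))      ≈⟨ x∙yz≈y∙xz _ _ _ ⟩
    binom x N * (natC (suc s) * binom (natC N) (suc s))      ≈⟨ *-congˡ (absorption s (natC N)) ⟩
    binom x N * ((natC N - natC s) * binom (natC N) s)       ≈⟨ x∙yz≈y∙xz _ _ _ ⟩
    (natC N - natC s) * (binom x N * binom (natC N) s)       ≈⟨ *-cong N-s≈1+j previous ⟩
    natC (suc j) * (binom x s * binom (x - natC s) (suc j))  ≈⟨ x∙yz≈y∙xz _ _ _ ⟩
    binom x s * (natC (suc j) * binom (x - natC s) (suc j))  ≈⟨ *-congˡ (absorption′ j (x - natC s)) ⟩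
    binom x s * ((x - natC s) * binom ((x - natC s) - 1#) j) ≈⟨ *-congˡ (*-congˡ (binom-cong j x-s-1≈x-[1+s])) ⟩
    binom x s * ((x - natC s) * binom (x - natC (suc s)) j)  ≈⟨ x∙yz≈yx∙z _ _ _ ⟩
    ((x - natC s) * binom x s) * binom (x - natC (suc s)) j  ≈⟨ *-congʳ (sym (absorption s x)) ⟩
    (natC (suc s) * binom x (suc s)) * binom (x - natC (suc s)) j ≈⟨ *-assoc _ _ _ ⟩
    natC (suc s) * (binom x (suc s) * binom (x - natC (suc s)) j) ∎)
    where
    N : ℕ
    N = suc (s ℕ.+ j)

    previous : binom x N * binom (natC N) s ≈ binom x s * binom (x - natC s) (suc j)
    previous = P.subst (λ v → binom x v * binom (natC v) s ≈ binom x s * binom (x - natC s) (suc j))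
                       (ℕP.+-suc s j) (trinomial x s (suc j))

    N-s≈1+j : natC N - natC s ≈ natC (suc j)
    N-s≈1+j = trans (+-congʳ (+-congˡ (natC-+ s j)))
      (solve 2 (λ a b → con 1ℤ :+ (a :+ b) :- a := con 1ℤ :+ b) refl (natC s) (natC j))

    x-s-1≈x-[1+s] : (x - natC s) - 1# ≈ x - natC (suc s)
    x-s-1≈x-[1+s] = solve 2 (λ x a → (x :- a) :- con 1ℤ := x :- (con 1ℤ :+ a)) refl x (natC s)

module Weights {c ℓ} (R : CommutativeRing c ℓ) (inv : ℕ → CommutativeRing.Carrier R)
               (isInv : QAlg.IsInvNat R inv) (k : ℕ) (a b : CommutativeRing.Carrier R)
               (a+b≈1+k : CommutativeRing._≈_ R (CommutativeRing._+_ R a b) (QAlg.natC R (suc k))) where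
  open CommutativeRing R hiding (zero)
  open QAlg R
  open WithInv inv
  open IntegerCoefficients R using (solve; _:=_; _:+_; _:-_; con)
  open FiniteSums R inv
  open Binomials R inv isInv
  open import Algebra.Properties.CommutativeSemigroup *-commutativeSemigroup
    using (x∙yz≈y∙xz; x∙yz≈y∙zx; x∙yz≈z∙xy; xy∙z≈xz∙y)
  open import Relation.Binary.Reasoning.Setoid setoid

  w : ℕ → Carrier
  w u = binom a u * binom b (k ∸ u)

  -- the weight at u = k-i, in the order in which it appears in the claimed formula
  w-reflected : ∀ {i} → i ≤ k → w (k ∸ i) ≈ binom b i * binom a (k ∸ i)
  w-reflected i≤k = trans (*-congˡ (reflexive (P.cong (binom b) (ℕP.m∸[m∸n]≡n i≤k)))) (*-comm _ _)

  moment : ℕ → Carrier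
  moment s = sumTo k (λ u → w u * binom (natC u) s)

  -- by trinomial revision and Vandermonde,  moment s = binom(a,s)·(k+1-s)  for s ≤ k
  moment-low : ∀ s → s ≤ k → moment s ≈ binom a s * natC (suc (k ∸ s))
  moment-low s s≤k = begin
    moment s
      ≈⟨ sum-dropInitial s k _ s≤k (λ u u<s → trans (*-congˡ (binom-nat-vanish u<s)) (zeroʳ _)) ⟩
    sumTo (k ∸ s) (λ v → w (s ℕ.+ v) * binom (natC (s ℕ.+ v)) s)
      ≈⟨ sum-cong (k ∸ s) (λ v _ → revise v) ⟩
    sumTo (k ∸ s) (λ v → binom a s * (binom (a - natC s) v * binom b ((k ∸ s) ∸ v)))
      ≈⟨ sym (sum-scale (k ∸ s) _ _) ⟩
    binom a s * sumTo (k ∸ s) (λ v → binom (a - natC s) v * binom b ((k ∸ s) ∸ v))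
      ≈⟨ *-congˡ (vandermonde (k ∸ s) _ _) ⟩
    binom a s * binom ((a - natC s) + b) (k ∸ s)
      ≈⟨ *-congˡ (binom-cong (k ∸ s) a-s+b≈1+[k-s]) ⟩
    binom a s * binom (natC (suc (k ∸ s))) (k ∸ s)
      ≈⟨ *-congˡ (binom-nat-pred (k ∸ s)) ⟩
    binom a s * natC (suc (k ∸ s)) ∎
    where
    revise : ∀ v → w (s ℕ.+ v) * binom (natC (s ℕ.+ v)) s
                   ≈ binom a s * (binom (a - natC s) v * binom b ((k ∸ s) ∸ v))
    revise v = begin
      (binom a (s ℕ.+ v) * binom b (k ∸ (s ℕ.+ v))) * binom (natC (s ℕ.+ v)) s
        ≈⟨ xy∙z≈xz∙y _ _ _ ⟩
      (binom a (s ℕ.+ v) * binom (natC (s ℕ.+ v)) s) * binom b (k ∸ (s ℕ.+ v))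
        ≈⟨ *-cong (trinomial a s v) (reflexive (P.cong (binom b) (P.sym (ℕP.∸-+-assoc k s v)))) ⟩
      (binom a s * binom (a - natC s) v) * binom b ((k ∸ s) ∸ v)
        ≈⟨ *-assoc _ _ _ ⟩
      binom a s * (binom (a - natC s) v * binom b ((k ∸ s) ∸ v)) ∎

    a-s+b≈1+[k-s] : (a - natC s) + b ≈ natC (suc (k ∸ s))
    a-s+b≈1+[k-s] = begin
      (a - natC s) + b                         ≈⟨ solve 3 (λ a b c → (a :- c) :+ b := (a :+ b) :- c) refl a b (natC s) ⟩
      (a + b) - natC s                         ≈⟨ +-congʳ a+b≈1+k ⟩
      (1# + natC k) - natC s                   ≈⟨ +-congʳ (+-congˡ (natC-split s≤k)) ⟩
      (1# + (natC s + natC (k ∸ s))) - natC s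
        ≈⟨ solve 2 (λ c d → (con 1ℤ :+ (c :+ d)) :- c := con 1ℤ :+ d) refl (natC s) (natC (k ∸ s)) ⟩
      natC (suc (k ∸ s))                       ∎

  moment-top : moment (suc k) ≈ 0#
  moment-top = sum-vanish k _ (λ u u≤k → trans (*-congˡ (binom-nat-vanish (s≤s u≤k))) (zeroʳ _))

  expansion : ∀ t → sumTo k (λ u → w u * natC ((t ℕ.+ u) C suc k)) ≈ natC t * binom (a + (natC t - 1#)) k
  expansion t = begin
    sumTo k (λ u → w u * natC ((t ℕ.+ u) C suc k))
      ≈⟨ sum-cong k (λ u _ → *-congˡ (split u)) ⟩
    sumTo k (λ u → w u * sumTo (suc k) (λ s → binom (natC u) s * binom (natC t) (suc k ∸ s)))
      ≈⟨ sum-cong k (λ u _ → sum-scale (suc k) _ _) ⟩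
    sumTo k (λ u → sumTo (suc k) (λ s → w u * (binom (natC u) s * binom (natC t) (suc k ∸ s))))
      ≈⟨ sum-interchange k (suc k) _ ⟩
    sumTo (suc k) (λ s → sumTo k (λ u → w u * (binom (natC u) s * binom (natC t) (suc k ∸ s))))
      ≈⟨ sum-cong (suc k) (λ s _ → trans (sum-cong k (λ u _ → x∙yz≈z∙xy _ _ _)) (sym (sum-scale k _ _))) ⟩
    sumTo (suc k) (λ s → binom (natC t) (suc k ∸ s) * moment s)
      ≈⟨ +-cong (sum-cong k lower) (trans (*-congˡ moment-top) (zeroʳ _)) ⟩
    sumTo k (λ s → natC t * (binom a s * binom (natC t - 1#) (k ∸ s))) + 0#
      ≈⟨ +-identityʳ _ ⟩
    sumTo k (λ s → natC t * (binom a s * binom (natC t - 1#) (k ∸ s)))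
      ≈⟨ sym (sum-scale k _ _) ⟩
    natC t * sumTo k (λ s → binom a s * binom (natC t - 1#) (k ∸ s))
      ≈⟨ *-congˡ (vandermonde k a (natC t - 1#)) ⟩
    natC t * binom (a + (natC t - 1#)) k ∎
    where
    split : ∀ u → natC ((t ℕ.+ u) C suc k) ≈ sumTo (suc k) (λ s → binom (natC u) s * binom (natC t) (suc k ∸ s))
    split u = trans (natC-binom (t ℕ.+ u) (suc k))
      (trans (binom-cong (suc k) (trans (natC-+ t u) (+-comm _ _))) (sym (vandermonde (suc k) (natC u) (natC t))))

    lower : ∀ s → s ≤ k → binom (natC t) (suc k ∸ s) * moment s ≈ natC t * (binom a s * binom (natC t - 1#) (k ∸ s))
    lower s s≤k rewrite ℕP.+-∸-assoc 1 s≤k = begin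
      binom (natC t) (suc (k ∸ s)) * moment s
        ≈⟨ *-congˡ (moment-low s s≤k) ⟩
      binom (natC t) (suc (k ∸ s)) * (binom a s * natC (suc (k ∸ s)))
        ≈⟨ x∙yz≈y∙zx _ _ _ ⟩
      binom a s * (natC (suc (k ∸ s)) * binom (natC t) (suc (k ∸ s)))
        ≈⟨ *-congˡ (absorption′ (k ∸ s) (natC t)) ⟩
      binom a s * (natC t * binom (natC t - 1#) (k ∸ s))
        ≈⟨ x∙yz≈y∙xz _ _ _ ⟩
      natC t * (binom a s * binom (natC t - 1#) (k ∸ s)) ∎

-- Multiplication of a power series Σ_t g(t) x^t by (1-x)^r:  its coefficient of x^m is
--   Δ r g m = Σ_{j≤m} (-1)^j C(r,j) g(m-j).
module Differences {c ℓ} (R : CommutativeRing c ℓ) (inv : ℕ → CommutativeRing.Carrier R) where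
  open CommutativeRing R hiding (zero)
  open QAlg R
  open WithInv inv
  open IntegerCoefficients R using (solve; _:=_; _:+_; _:*_; :-_; con)
  open FiniteSums R inv
  open import Algebra.Properties.CommutativeSemigroup *-commutativeSemigroup using (x∙yz≈y∙xz)
  open import Algebra.Properties.AbelianGroup +-abelianGroup using (xyx⁻¹≈y)
  open import Relation.Binary.Reasoning.Setoid setoid

  Δ : ℕ → (ℕ → Carrier) → ℕ → Carrier
  Δ r g m = sumTo m (λ j → sign j * natC (r C j) * g (m ∸ j))

  Δ-cong : ∀ r {f g : ℕ → Carrier} m → (∀ t → f t ≈ g t) → Δ r f m ≈ Δ r g m
  Δ-cong r m f≈g = sum-cong m (λ j _ → *-congˡ (f≈g (m ∸ j)))

  Δ-+ : ∀ r (f g : ℕ → Carrier) m → Δ r (λ t → f t + g t) m ≈ Δ r f m + Δ r g m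
  Δ-+ r f g m = trans (sum-cong m (λ j _ → distribˡ _ _ _)) (sum-+ m _ _)

  Δ-scale : ∀ r x (g : ℕ → Carrier) m → Δ r (λ t → x * g t) m ≈ x * Δ r g m
  Δ-scale r x g m = trans (sum-cong m (λ j _ → x∙yz≈y∙xz _ _ _)) (sym (sum-scale m x _))

  Δ-sum : ∀ r n (F : ℕ → ℕ → Carrier) m →
    Δ r (λ t → sumTo n (λ u → F u t)) m ≈ sumTo n (λ u → Δ r (F u) m)
  Δ-sum r n F m = trans (sum-cong m (λ j _ → sum-scale n _ _)) (sum-interchange m n _)

  Δ-vanish : ∀ r m → Δ r (λ _ → 0#) m ≈ 0#
  Δ-vanish r m = sum-vanish m _ (λ j _ → zeroʳ _)

  Δ-at-0 : ∀ r g → Δ r g 0 ≈ g 0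
  Δ-at-0 r g = solve 1 (λ G → con 1ℤ :* (con 1ℤ :+ con (+ 0)) :* G := G) refl (g 0)

  Δ-order-0 : ∀ g m → Δ 0 g m ≈ g m
  Δ-order-0 g zero = Δ-at-0 0 g
  Δ-order-0 g (suc m) = begin
    Δ 0 g (suc m)
      ≈⟨ sum-unfoldˡ m _ ⟩
    sign 0 * natC (0 C 0) * g (suc m) + sumTo m (λ j → sign (suc j) * natC (0 C suc j) * g (m ∸ j))
      ≈⟨ +-cong (Δ-at-0 0 (λ _ → g (suc m))) (sum-vanish m _ (λ j _ → trans (*-congʳ (zeroʳ _)) (zeroˡ _))) ⟩
    g (suc m) + 0#
      ≈⟨ +-identityʳ _ ⟩
    g (suc m) ∎

  -- (1-x)^(r+1) = (1-x)^r - x·(1-x)^r, by Pascal's rule for C(r+1, j)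
  Δ-step : ∀ r g m → Δ (suc r) g (suc m) ≈ Δ r g (suc m) - Δ r g m
  Δ-step r g m = begin
    Δ (suc r) g (suc m)
      ≈⟨ sum-unfoldˡ m _ ⟩
    first + sumTo m (λ j → sign (suc j) * natC (suc r C suc j) * g (m ∸ j))
      ≈⟨ +-congˡ (sum-cong m (λ j _ → pascal-term j)) ⟩
    first + sumTo m (λ j → sign (suc j) * natC (r C suc j) * g (m ∸ j) + - (sign j * natC (r C j) * g (m ∸ j)))
      ≈⟨ +-congˡ (trans (sum-+ m _ _) (+-congˡ (sum-neg m _))) ⟩
    first + (sumTo m (λ j → sign (suc j) * natC (r C suc j) * g (m ∸ j)) - Δ r g m)
      ≈⟨ sym (+-assoc _ _ _) ⟩
    (first + sumTo m (λ j → sign (suc j) * natC (r C suc j) * g (m ∸ j))) - Δ r g m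
      ≈⟨ +-congʳ (sym (sum-unfoldˡ m _)) ⟩
    Δ r g (suc m) - Δ r g m ∎
    where
    first : Carrier
    first = sign 0 * natC (r C 0) * g (suc m)

    pascal-term : ∀ j → sign (suc j) * natC (suc r C suc j) * g (m ∸ j)
                        ≈ sign (suc j) * natC (r C suc j) * g (m ∸ j) + - (sign j * natC (r C j) * g (m ∸ j))
    pascal-term j = begin
      - sign j * natC (suc r C suc j) * g (m ∸ j)
        ≡⟨ P.cong (λ v → - sign j * natC v * g (m ∸ j)) (P.sym (nCk+nC[k+1]≡[n+1]C[k+1] r j)) ⟩
      - sign j * natC (r C j ℕ.+ r C suc j) * g (m ∸ j)
        ≈⟨ *-congʳ (*-congˡ (natC-+ (r C j) (r C suc j))) ⟩
      - sign j * (natC (r C j) + natC (r C suc j)) * g (m ∸ j)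
        ≈⟨ solve 4 (λ S A B G → (:- S) :* (A :+ B) :* G := (:- S) :* B :* G :+ (:- (S :* A :* G)))
                 refl (sign j) (natC (r C j)) (natC (r C suc j)) (g (m ∸ j)) ⟩
      - sign j * natC (r C suc j) * g (m ∸ j) + - (sign j * natC (r C j) * g (m ∸ j)) ∎

  -- multiplying by x:  if g(0) = 0 and g(t+1) = h(t) + g′(t), then the coefficient of
  -- x^(m+1) in (1-x)^r·G is that of x^m in (1-x)^r·(H + G′)
  Δ-shift : ∀ r (g h g′ : ℕ → Carrier) → g 0 ≈ 0# → (∀ t → g (suc t) ≈ h t + g′ t) →
    ∀ m → Δ r g (suc m) ≈ Δ r h m + Δ r g′ m
  Δ-shift r g h g′ g0≈0 g-succ m = begin
    Δ r g (suc m)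
      ≈⟨ +-cong (sum-cong m (λ j j≤m → *-congˡ (trans (reflexive (P.cong g (ℕP.+-∸-assoc 1 j≤m)))
                                                       (g-succ (m ∸ j)))))
                (trans (*-congˡ (trans (reflexive (P.cong g (ℕP.n∸n≡0 m))) g0≈0)) (zeroʳ _)) ⟩
    Δ r (λ t → h t + g′ t) m + 0#
      ≈⟨ +-identityʳ _ ⟩
    Δ r (λ t → h t + g′ t) m
      ≈⟨ Δ-+ r h g′ m ⟩
    Δ r h m + Δ r g′ m ∎

  δ : ℕ → ℕ → Carrier
  δ zero zero = 1#
  δ zero (suc _) = 0#
  δ (suc _) zero = 0#
  δ (suc m) (suc n) = δ m n

  δ-refl : ∀ n → δ n n ≈ 1#
  δ-refl zero = refl
  δ-refl (suc n) = δ-refl n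

  δ-≢ : ∀ m n → m ≢ n → δ m n ≈ 0#
  δ-≢ zero zero m≢n = ⊥-elim (m≢n P.refl)
  δ-≢ zero (suc n) m≢n = refl
  δ-≢ (suc m) zero m≢n = refl
  δ-≢ (suc m) (suc n) m≢n = δ-≢ m n (λ m≡n → m≢n (P.cong suc m≡n))

  natC-C-δ : ∀ v r → v ≤ r → natC (v C r) ≈ δ v r
  natC-C-δ v r v≤r with v ℕP.≟ r
  ... | yes P.refl = trans (reflexive (P.cong natC (nCn≡1 v))) (trans (+-identityʳ 1#) (sym (δ-refl v)))
  ... | no v≢r = trans (reflexive (P.cong natC (k>n⇒nCk≡0 (ℕP.≤∧≢⇒< v≤r v≢r)))) (sym (δ-≢ v r v≢r))

  sum-δ-hit : ∀ k m n (f : ℕ → Carrier) → m ≤ n → n ∸ m ≤ k →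
    sumTo k (λ u → f u * δ (m ℕ.+ u) n) ≈ f (n ∸ m)
  sum-δ-hit k m n f m≤n n-m≤k = begin
    sumTo k (λ u → f u * δ (m ℕ.+ u) n)
      ≈⟨ sum-single k (n ∸ m) _ n-m≤k
           (λ u _ u≢n-m → trans (*-congˡ (δ-≢ (m ℕ.+ u) n (miss u u≢n-m))) (zeroʳ _)) ⟩
    f (n ∸ m) * δ (m ℕ.+ (n ∸ m)) n
      ≈⟨ *-congˡ (trans (reflexive (P.cong (λ v → δ v n) (ℕP.m+[n∸m]≡n m≤n))) (δ-refl n)) ⟩
    f (n ∸ m) * 1#
      ≈⟨ *-identityʳ _ ⟩
    f (n ∸ m) ∎
    where
    miss : ∀ u → u ≢ n ∸ m → m ℕ.+ u ≢ n
    miss u u≢n-m m+u≡n = u≢n-m (P.trans (P.sym (ℕP.m+n∸m≡n m u)) (P.cong (_∸ m) m+u≡n))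

  sum-δ-miss : ∀ k m n (f : ℕ → Carrier) → (∀ u → u ≤ k → m ℕ.+ u ≢ n) →
    sumTo k (λ u → f u * δ (m ℕ.+ u) n) ≈ 0#
  sum-δ-miss k m n f miss = sum-vanish k _ (λ u u≤k → trans (*-congˡ (δ-≢ (m ℕ.+ u) n (miss u u≤k))) (zeroʳ _))

  series : ℕ → ℕ → ℕ → Carrier
  series r v m = Δ (suc r) (λ t → natC ((t ℕ.+ v) C r)) m

  private
    pascal-natC : ∀ x q → natC (suc x C suc q) ≈ natC (x C q) + natC (x C suc q)
    pascal-natC x q = trans (reflexive (P.cong natC (P.sym (nCk+nC[k+1]≡[n+1]C[k+1] x q))))
                            (natC-+ (x C q) (x C suc q))

    cancelʳ : ∀ A B → (A + B) - B ≈ A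
    cancelʳ A B = trans (+-congʳ (+-comm A B)) (xyx⁻¹≈y B A)

  series-lower : ∀ q v m → v ≤ q → series (suc q) v (suc m) ≈ series q v m
  series-lower q v m v≤q = begin
    series (suc q) v (suc m)                         ≈⟨ Δ-step (suc q) g m ⟩
    Δ (suc q) g (suc m) - Δ (suc q) g m
      ≈⟨ +-congʳ (Δ-shift (suc q) g h g g0≈0 (λ t → pascal-natC (t ℕ.+ v) q) m) ⟩
    (Δ (suc q) h m + Δ (suc q) g m) - Δ (suc q) g m  ≈⟨ cancelʳ _ _ ⟩
    series q v m                                     ∎
    where
    g h : ℕ → Carrier
    g t = natC ((t ℕ.+ v) C suc q)
    h t = natC ((t ℕ.+ v) C q)

    g0≈0 : g 0 ≈ 0#
    g0≈0 = reflexive (P.cong natC (k>n⇒nCk≡0 (s≤s v≤q)))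

  series-diagonal : ∀ q m → series (suc q) (suc q) (suc m) ≈ series q q (suc m)
  series-diagonal q m = begin
    series (suc q) (suc q) (suc m)
      ≈⟨ Δ-step (suc q) g m ⟩
    Δ (suc q) g (suc m) - Δ (suc q) g m
      ≈⟨ +-congʳ (trans (Δ-cong (suc q) (suc m) split) (Δ-+ (suc q) h g′ (suc m))) ⟩
    (Δ (suc q) h (suc m) + Δ (suc q) g′ (suc m)) - Δ (suc q) g m
      ≈⟨ +-congʳ (+-congˡ shifted) ⟩
    (Δ (suc q) h (suc m) + Δ (suc q) g m) - Δ (suc q) g m
      ≈⟨ cancelʳ _ _ ⟩
    series q q (suc m) ∎
    where
    g h g′ : ℕ → Carrier
    g t = natC ((t ℕ.+ suc q) C suc q)
    h t = natC ((t ℕ.+ q) C q)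
    g′ t = natC ((t ℕ.+ q) C suc q)

    split : ∀ t → g t ≈ h t + g′ t
    split t = trans (reflexive (P.cong (λ v → natC (v C suc q)) (ℕP.+-suc t q))) (pascal-natC (t ℕ.+ q) q)

    shifted : Δ (suc q) g′ (suc m) ≈ Δ (suc q) g m
    shifted = begin
      Δ (suc q) g′ (suc m)
        ≈⟨ Δ-shift (suc q) g′ (λ _ → 0#) g (reflexive (P.cong natC (k>n⇒nCk≡0 (ℕP.n<1+n q))))
                   (λ t → trans (reflexive (P.cong (λ v → natC (v C suc q)) (P.sym (ℕP.+-suc t q))))
                                (sym (+-identityˡ _))) m ⟩
      Δ (suc q) (λ _ → 0#) m + Δ (suc q) g m
        ≈⟨ +-congʳ (Δ-vanish (suc q) m) ⟩
      0# + Δ (suc q) g m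
        ≈⟨ +-identityˡ _ ⟩
      Δ (suc q) g m ∎

  series-monomial : ∀ r v m → v ≤ r → series r v m ≈ δ (m ℕ.+ v) r
  series-monomial r v zero v≤r = trans (Δ-at-0 (suc r) (λ t → natC ((t ℕ.+ v) C r))) (natC-C-δ v r v≤r)
  series-monomial zero zero (suc m) z≤n = begin
    series 0 0 (suc m)               ≈⟨ Δ-step 0 g m ⟩
    Δ 0 g (suc m) - Δ 0 g m          ≈⟨ +-cong (Δ-order-0 g (suc m)) (-‿cong (Δ-order-0 g m)) ⟩
    natC 1 - natC 1                  ≈⟨ -‿inverseʳ _ ⟩
    0#                               ∎
    where
    g : ℕ → Carrier
    g t = natC ((t ℕ.+ 0) C 0)
  series-monomial (suc q) v (suc m) v≤1+q with v ℕP.≟ suc q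
  ... | yes P.refl = begin
    series (suc q) (suc q) (suc m)   ≈⟨ series-diagonal q m ⟩
    series q q (suc m)               ≈⟨ series-monomial q q (suc m) ℕP.≤-refl ⟩
    δ (suc m ℕ.+ q) q                ≡⟨ P.cong (λ n → δ n q) (P.sym (ℕP.+-suc m q)) ⟩
    δ (suc m ℕ.+ suc q) (suc q)      ∎
  ... | no v≢1+q = trans (series-lower q v m v≤q) (series-monomial q v m v≤q)
    where
    v≤q : v ≤ q
    v≤q = ℕP.≤-pred (ℕP.≤∧≢⇒< v≤1+q v≢1+q)

module Numerator {c ℓ} (R : CommutativeRing c ℓ) (inv : ℕ → CommutativeRing.Carrier R)
                 (isInv : QAlg.IsInvNat R inv) (k : ℕ) (β : CommutativeRing.Carrier R) where
  open CommutativeRing R hiding (zero)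
  open QAlg R
  open WithInv inv
  open IntegerCoefficients R using (solve; _:=_; _:+_; _:*_; _:-_; con)
  open FiniteSums R inv using (sum-cong)
  open Binomials R inv isInv using (binom-cong)
  open Differences R inv public using (δ; sum-δ-hit; sum-δ-miss)
  open Differences R inv using (Δ; Δ-cong; Δ-scale; Δ-sum; series-monomial)
  open import Algebra.Properties.CommutativeSemigroup *-commutativeSemigroup using (xy∙z≈y∙xz)
  open import Relation.Binary.Reasoning.Setoid setoid

  a b : Carrier
  a = natC (suc k) * β
  b = natC (suc k) * (1# - β)

  a+b≈1+k : a + b ≈ natC (suc k)
  a+b≈1+k = solve 2 (λ N x → N :* x :+ N :* (con 1ℤ :- x) := N) refl (natC (suc k)) β

  open Weights R inv isInv k a b a+b≈1+k public using (w; w-reflected; expansion)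

  diagCoeff-expansion : ∀ t → diagCoeff k β t ≈ inv k * sumTo k (λ u → w u * natC ((t ℕ.+ u) C suc k))
  diagCoeff-expansion t = begin
    natC t * inv k * binom (natC t + a - 1#) k
      ≈⟨ *-congˡ (binom-cong k (solve 2 (λ x y → x :+ y :- con 1ℤ := y :+ (x :- con 1ℤ)) refl (natC t) a)) ⟩
    natC t * inv k * binom (a + (natC t - 1#)) k
      ≈⟨ xy∙z≈y∙xz _ _ _ ⟩
    inv k * (natC t * binom (a + (natC t - 1#)) k)
      ≈⟨ *-congˡ (sym (expansion t)) ⟩
    inv k * sumTo k (λ u → w u * natC ((t ℕ.+ u) C suc k)) ∎

  Pcoeff-weights : ∀ m → Pcoeff k β m ≈ inv k * sumTo k (λ u → w u * δ (m ℕ.+ u) (suc k))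
  Pcoeff-weights m = begin
    Pcoeff k β m
      ≈⟨ Δ-cong (suc (suc k)) m diagCoeff-expansion ⟩
    Δ (suc (suc k)) (λ t → inv k * expanded t) m
      ≈⟨ Δ-scale (suc (suc k)) (inv k) expanded m ⟩
    inv k * Δ (suc (suc k)) expanded m
      ≈⟨ *-congˡ (Δ-sum (suc (suc k)) k (λ u t → w u * basis u t) m) ⟩
    inv k * sumTo k (λ u → Δ (suc (suc k)) (λ t → w u * basis u t) m)
      ≈⟨ *-congˡ (sum-cong k (λ u u≤k → trans (Δ-scale (suc (suc k)) (w u) (basis u) m)
                                          (*-congˡ (series-monomial (suc k) u m (ℕP.m≤n⇒m≤1+n u≤k))))) ⟩
    inv k * sumTo k (λ u → w u * δ (m ℕ.+ u) (suc k)) ∎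
    where
    basis : ℕ → ℕ → Carrier
    basis u t = natC ((t ℕ.+ u) C suc k)

    expanded : ℕ → Carrier
    expanded t = sumTo k (λ u → w u * basis u t)

theorem5 : ∀ {c ℓ} (R : CommutativeRing c ℓ) (inv : ℕ → CommutativeRing.Carrier R) →
    QAlg.IsInvNat R inv →
    (β : CommutativeRing.Carrier R) (k m : ℕ) →
    CommutativeRing._≈_ R (QAlg.WithInv.Pcoeff R inv k β m) (QAlg.WithInv.rhsCoeff R inv k β m)
theorem5 R inv isInv β k = coefficient
  where
  open CommutativeRing R hiding (zero)
  open QAlg.WithInv R inv
  open Numerator R inv isInv k β
  open import Relation.Binary.Reasoning.Setoid setoid

  coefficient : ∀ m → Pcoeff k β m ≈ rhsCoeff k β m
  coefficient zero = begin
    Pcoeff k β 0                               ≈⟨ Pcoeff-weights 0 ⟩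
    inv k * sumTo k (λ u → w u * δ u (suc k))
      ≈⟨ *-congˡ (sum-δ-miss k 0 (suc k) w (λ u u≤k → ℕP.<⇒≢ (s≤s u≤k))) ⟩
    inv k * 0#                                 ≈⟨ zeroʳ _ ⟩
    0#                                         ∎
  coefficient (suc i) with i ≤ᵇ k in i≤ᵇk
  ... | true = begin
    Pcoeff k β (suc i)                                      ≈⟨ Pcoeff-weights (suc i) ⟩
    inv k * sumTo k (λ u → w u * δ (suc i ℕ.+ u) (suc k))
      ≈⟨ *-congˡ (sum-δ-hit k (suc i) (suc k) w (s≤s i≤k) (ℕP.m∸n≤m k i)) ⟩
    inv k * w (k ∸ i)                                       ≈⟨ *-congˡ (w-reflected i≤k) ⟩
    inv k * (binom b i * binom a (k ∸ i))                   ≈⟨ sym (*-assoc _ _ _) ⟩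
    inv k * binom b i * binom a (k ∸ i)                     ∎
    where
    i≤k : i ≤ k
    i≤k = ℕP.≤ᵇ⇒≤ i k (P.subst T (P.sym i≤ᵇk) _)
  ... | false = begin
    Pcoeff k β (suc i)                                      ≈⟨ Pcoeff-weights (suc i) ⟩
    inv k * sumTo k (λ u → w u * δ (suc i ℕ.+ u) (suc k))   ≈⟨ *-congˡ (sum-δ-miss k (suc i) (suc k) w miss) ⟩
    inv k * 0#                                              ≈⟨ zeroʳ _ ⟩
    0#                                                      ∎
    where
    i≰k : ¬ i ≤ k
    i≰k i≤k = P.subst T i≤ᵇk (ℕP.≤⇒≤ᵇ i≤k)

    miss : ∀ u → u ≤ k → suc i ℕ.+ u ≢ suc k
    miss u _ 1+i+u≡1+k = i≰k (P.subst (i ≤_) (ℕP.suc-injective 1+i+u≡1+k) (ℕP.m≤m+n i u))
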